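{- For any integer $n\geq1$, there is an isomorphism of ranked posets $\psi_n:\mathcal{N}(n,1)\simeq\mathcal{Q}(n)$, given by $[1,0^{c_1},1,0^{c_2},\dots,1,0^{c_r}]\mapsto[c_1+1,\dots,c_r+1]$.
   Context: $\mathcal{N}(n,1)$ is the set of $n$-bead binary necklaces (orbits of $\{0,1\}^n$ under cyclic rotation by $\mathbb{Z}_n$) with the necklaces $[0,\dots,0]$ and $[1,\dots,1]$ removed, ordered by $[x]\leq[y]$ iff some rotations $x',y'$ of $x,y$ satisfy $x'\leq y'$ componentwise, and ranked by the number of $1$'s. For $1\leq r\leq n$, $\mathcal{P}(n,r)$ is the set of ordered partitions $(a_1,\dots,a_r)\in\mathbb{Z}_{>0}^r$ with $\sum a_i=n$, and $\mathcal{P}(n)=\bigsqcup_{r=1}^{n-1}\mathcal{P}(n,r)$, partially ordered by refinement (a partition is below each partition obtained from it by splitting each part into an ordered sequence of positive parts with the same sum) and ranked by number of parts. $\mathcal{Q}(n)=\bigsqcup_{r=1}^{n-1}\mathcal{P}(n,r)/\mathbb{Z}_r$ is the set of partition necklaces $[a_1,\dots,a_r]$ ($\mathbb{Z}_r$-orbits under cyclic rotation), with the ranked poset structure inherited from $\mathcal{P}(n)$: $[a]\leq[b]$ iff some rotation of $b$ refines some rotation of $a$, and rank equal to the number of parts. The notation $0^{c}$ denotes $c$ consecutive zeros. -}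

module Defs where

open import Data.Nat using (ℕ; zero; suc; _≤_; _<_; _∸_)
open import Data.Bool using (Bool; true; false)
import Data.Bool as B
open import Data.List using (List; []; _∷_; _++_; length; drop; take; map; replicate; concatMap)
open import Data.Nat.ListAction using (sum)
open import Data.List.Relation.Unary.All using (All)
open import Data.List.Membership.Propositional using (_∈_)
open import Data.List.Relation.Binary.Pointwise using (Pointwise)
open import Data.Product using (Σ; ∃; ∃-syntax; _×_; _,_; proj₁)
open import Relation.Binary.PropositionalEquality using (_≡_; _≢_)
open import Function.Bundles using (_⇔_)

Rot : {A : Set} → List A → List A → Set
Rot xs ys = ∃[ k ] (k ≤ length xs × ys ≡ drop k xs ++ take k xs)

-- N(n,1): binary words of length n, neither all 0 nor all 1,
-- considered up to rotation (necklaces as a setoid of representatives).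

NWord : ℕ → Set
NWord n = Σ (List Bool) λ w → length w ≡ n × true ∈ w × false ∈ w

_~N_ : ∀ {n} → NWord n → NWord n → Set
x ~N y = Rot (proj₁ x) (proj₁ y)

_≤N_ : ∀ {n} → NWord n → NWord n → Set
x ≤N y = ∃[ x' ] ∃[ y' ] (Rot (proj₁ x) x' × Rot (proj₁ y) y' × Pointwise B._≤_ x' y')

countTrue : List Bool → ℕ
countTrue [] = zero
countTrue (true ∷ w) = suc (countTrue w)
countTrue (false ∷ w) = countTrue w

rankN : ∀ {n} → NWord n → ℕ
rankN x = countTrue (proj₁ x)

Part : ℕ → Set
Part n = Σ (List ℕ) λ a → All (λ c → 0 < c) a × sum a ≡ n × 1 ≤ length a × length a ≤ n ∸ 1

_~Q_ : ∀ {n} → Part n → Part n → Set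
a ~Q b = Rot (proj₁ a) (proj₁ b)

data Refines : List ℕ → List ℕ → Set where
  ref-[] : Refines [] []
  ref-∷  : ∀ {a as rest} (bs : List ℕ) → bs ≢ [] → sum bs ≡ a →
           Refines as rest → Refines (a ∷ as) (bs ++ rest)

_≤Q_ : ∀ {n} → Part n → Part n → Set
a ≤Q b = ∃[ a' ] ∃[ b' ] (Rot (proj₁ a) a' × Rot (proj₁ b) b' × Refines a' b')

rankQ : ∀ {n} → Part n → ℕ
rankQ a = length (proj₁ a)

gapWord : List ℕ → List Bool
gapWord = concatMap (λ c → true ∷ replicate c false)

IsRankedIso : ∀ {n} → (NWord n → Part n) → Set
IsRankedIso {n} ψ =
  (∀ x y → x ~N y → ψ x ~Q ψ y) ×
  (∀ x y → ψ x ~Q ψ y → x ~N y) ×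
  (∀ q → ∃[ x ] (ψ x ~Q q)) ×
  (∀ x y → (x ≤N y) ⇔ (ψ x ≤Q ψ y)) ×
  (∀ x → rankQ (ψ x) ≡ rankN x) ×
  (∀ (cs : List ℕ) (x : NWord n) → proj₁ x ≡ gapWord cs →
     Rot (proj₁ (ψ x)) (map suc cs))

module Submission where

-- Cutting a binary word just before each of its 1's writes it as
-- 1 0^{c₁} 1 0^{c₂} … 1 0^{c_r}, i.e. as  gapWord cs  for the gap sequence
-- cs = [c₁, …, c_r]; every word containing a 1 has a rotation of this form.
--
-- Rotations are handled as prefix/suffix swaps  u ++ v ↦ v ++ u  (the relation
-- _↻_ below).  It is equivalent to the relation Rot of the statement but makes
-- symmetry and transitivity elementary.

open import Defs
open import Data.Nat using (ℕ; _≤_)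
open import Data.Product using (Σ)

open import Data.Nat using (zero; suc; _+_; _∸_; _<_; z≤n; s≤s; pred)
open import Data.Nat.Properties using (+-comm; 0<1+n; m≤n⇒m≤1+n)
open import Data.Nat.ListAction using (sum)
open import Data.Bool using (Bool; true; false)
import Data.Bool as B
open import Data.List using (List; []; _∷_; _++_; length; drop; take; map; replicate)
open import Data.List.Properties
  using (map-++; length-map; length-++; length-++-comm; length-++-≤ˡ; ++-assoc; ++-identityʳ;
         take++drop≡id; ∷-injectiveˡ; ∷-injectiveʳ; length-replicate; concatMap-++; map-∘; map-id)
open import Data.List.Relation.Unary.All using (All; []; _∷_; universal)
import Data.List.Relation.Unary.All.Properties as All
open import Data.List.Membership.Propositional using (_∈_)
open import Data.List.Membership.Propositional.Properties using (∈-∃++; ∈-++⁻; ∈-++⁺ˡ; ∈-++⁺ʳ)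
open import Data.List.Relation.Unary.Any using (here; there)
open import Data.List.Relation.Binary.Pointwise using (Pointwise; []; _∷_; ++⁺)
open import Data.List.Relation.Binary.Pointwise.Properties using (Pointwise-length)
open import Data.Product using (∃-syntax; ∃₂; _×_; _,_; proj₁; proj₂)
open import Data.Sum using (_⊎_; inj₁; inj₂)
open import Data.Empty using (⊥-elim)
open import Relation.Binary.PropositionalEquality
open import Function.Bundles using (mk⇔)

infix 4 _↻_

_↻_ : {A : Set} → List A → List A → Set
xs ↻ ys = ∃₂ λ u v → xs ≡ u ++ v × ys ≡ v ++ u

module _ {A : Set} where

  ↻-refl : {xs : List A} → xs ↻ xs
  ↻-refl {xs} = [] , xs , refl , sym (++-identityʳ xs)

  ↻-sym : {xs ys : List A} → xs ↻ ys → ys ↻ xs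
  ↻-sym (u , v , p , q) = v , u , q , p

  ++-overlap : ∀ (p q v u : List A) → p ++ q ≡ v ++ u →
               (∃[ r ] (v ≡ p ++ r × q ≡ r ++ u)) ⊎ (∃[ s ] (p ≡ v ++ s × u ≡ s ++ q))
  ++-overlap []      q v       u eq = inj₁ (v , refl , eq)
  ++-overlap (x ∷ p) q []      u eq = inj₂ (x ∷ p , refl , sym eq)
  ++-overlap (x ∷ p) q (y ∷ v) u eq
    with refl ← ∷-injectiveˡ eq | ++-overlap p q v u (∷-injectiveʳ eq)
  ... | inj₁ (r , refl , q≡) = inj₁ (r , refl , q≡)
  ... | inj₂ (s , refl , u≡) = inj₂ (s , refl , u≡)

  ↻-trans : {xs ys zs : List A} → xs ↻ ys → ys ↻ zs → xs ↻ zs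
  ↻-trans (u , v , refl , e) (p , q , refl , refl) with ++-overlap p q v u e
  ... | inj₁ (r , refl , refl) = u ++ p , r , sym (++-assoc u p r) , ++-assoc r u p
  ... | inj₂ (s , refl , refl) = s , q ++ v , ++-assoc s q v , sym (++-assoc q v s)

  drop-length-++ : ∀ (u v : List A) → drop (length u) (u ++ v) ≡ v
  drop-length-++ []      v = refl
  drop-length-++ (x ∷ u) v = drop-length-++ u v

  take-length-++ : ∀ (u v : List A) → take (length u) (u ++ v) ≡ u
  take-length-++ []      v = refl
  take-length-++ (x ∷ u) v = cong (x ∷_) (take-length-++ u v)

  Rot⇒↻ : {xs ys : List A} → Rot xs ys → xs ↻ ys
  Rot⇒↻ {xs} (k , _ , refl) = take k xs , drop k xs , sym (take++drop≡id k xs) , refl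

  ↻⇒Rot : {xs ys : List A} → xs ↻ ys → Rot xs ys
  ↻⇒Rot (u , v , refl , refl) =
    length u , length-++-≤ˡ u , sym (cong₂ _++_ (drop-length-++ u v) (take-length-++ u v))

  ↻-length : {xs ys : List A} → xs ↻ ys → length xs ≡ length ys
  ↻-length (u , v , refl , refl) = length-++-comm u v

  ↻-∈ : {x : A} {xs ys : List A} → x ∈ xs → xs ↻ ys → x ∈ ys
  ↻-∈ x∈ (u , v , refl , refl) with ∈-++⁻ u x∈
  ... | inj₁ x∈u = ∈-++⁺ʳ v x∈u
  ... | inj₂ x∈v = ∈-++⁺ˡ x∈v

  ↻-All : {P : A → Set} {xs ys : List A} → All P xs → xs ↻ ys → All P ys
  ↻-All all (u , v , refl , refl) with All.++⁻ u all
  ... | all-u , all-v = All.++⁺ all-v all-u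

  Pointwise-split : {B : Set} {R : A → B → Set} (u : List A) {v : List A} {ys : List B} →
                    Pointwise R (u ++ v) ys →
                    ∃₂ λ ys₁ ys₂ → ys ≡ ys₁ ++ ys₂ × Pointwise R u ys₁ × Pointwise R v ys₂
  Pointwise-split []      p       = [] , _ , refl , [] , p
  Pointwise-split (x ∷ u) (r ∷ p) with Pointwise-split u p
  ... | ys₁ , ys₂ , refl , p₁ , p₂ = _ ∷ ys₁ , ys₂ , refl , r ∷ p₁ , p₂

  ↻-Pointwise : {B : Set} {R : A → B → Set} {xs xs′ : List A} {ys : List B} →
                Pointwise R xs ys → xs ↻ xs′ → ∃[ ys′ ] (ys ↻ ys′ × Pointwise R xs′ ys′)
  ↻-Pointwise p (u , v , refl , refl) with Pointwise-split u p
  ... | ys₁ , ys₂ , refl , p₁ , p₂ = ys₂ ++ ys₁ , (ys₁ , ys₂ , refl , refl) , ++⁺ p₂ p₁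

↻-map : {A B : Set} (f : A → B) {xs ys : List A} → xs ↻ ys → map f xs ↻ map f ys
↻-map f (u , v , refl , refl) = map f u , map f v , map-++ f u v , map-++ f v u

map-pred-suc : ∀ cs → map pred (map suc cs) ≡ cs
map-pred-suc cs = trans (sym (map-∘ cs)) (map-id cs)

↻-unsuc : {cs : List ℕ} {a : List ℕ} → map suc cs ↻ a → cs ↻ map pred a
↻-unsuc {cs} h = subst (_↻ _) (map-pred-suc cs) (↻-map pred h)

countTrue-++ : ∀ xs ys → countTrue (xs ++ ys) ≡ countTrue xs + countTrue ys
countTrue-++ []           ys = refl
countTrue-++ (true ∷ xs)  ys = cong suc (countTrue-++ xs ys)
countTrue-++ (false ∷ xs) ys = countTrue-++ xs ys

↻-countTrue : {xs ys : List Bool} → xs ↻ ys → countTrue xs ≡ countTrue ys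
↻-countTrue (u , v , refl , refl) = begin
  countTrue (u ++ v)          ≡⟨ countTrue-++ u v ⟩
  countTrue u + countTrue v   ≡⟨ +-comm (countTrue u) (countTrue v) ⟩
  countTrue v + countTrue u   ≡⟨ countTrue-++ v u ⟨
  countTrue (v ++ u)          ∎
  where open ≡-Reasoning

countTrue≤length : ∀ w → countTrue w ≤ length w
countTrue≤length []          = z≤n
countTrue≤length (true ∷ w)  = s≤s (countTrue≤length w)
countTrue≤length (false ∷ w) = m≤n⇒m≤1+n (countTrue≤length w)

true∈⇒countTrue : ∀ {w} → true ∈ w → 1 ≤ countTrue w
true∈⇒countTrue {true ∷ w}  _         = s≤s z≤n
true∈⇒countTrue {false ∷ w} (there t) = true∈⇒countTrue t

countTrue⇒true∈ : ∀ w → 1 ≤ countTrue w → true ∈ w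
countTrue⇒true∈ (true ∷ w)  _ = here refl
countTrue⇒true∈ (false ∷ w) p = there (countTrue⇒true∈ w p)

false∈⇒countTrue : ∀ {w} → false ∈ w → countTrue w < length w
false∈⇒countTrue {false ∷ w} _         = s≤s (countTrue≤length w)
false∈⇒countTrue {true ∷ w}  (there f) = s≤s (false∈⇒countTrue f)

countTrue⇒false∈ : ∀ w → countTrue w < length w → false ∈ w
countTrue⇒false∈ (false ∷ w) _       = here refl
countTrue⇒false∈ (true ∷ w)  (s≤s p) = there (countTrue⇒false∈ w p)

gapWord-++ : ∀ cs ds → gapWord (cs ++ ds) ≡ gapWord cs ++ gapWord ds
gapWord-++ = concatMap-++ _

length-gapWord : ∀ cs → length (gapWord cs) ≡ sum (map suc cs)
length-gapWord []       = refl
length-gapWord (c ∷ cs) =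
  cong suc (trans (length-++ (replicate c false))
                  (cong₂ _+_ (length-replicate c) (length-gapWord cs)))

countTrue-gapWord : ∀ cs → countTrue (gapWord cs) ≡ length cs
countTrue-gapWord []       = refl
countTrue-gapWord (c ∷ cs) = cong suc (countTrue-after-falses c)
  where
    countTrue-after-falses : ∀ k → countTrue (replicate k false ++ gapWord cs) ≡ length cs
    countTrue-after-falses zero    = countTrue-gapWord cs
    countTrue-after-falses (suc k) = countTrue-after-falses k

falses-then-gapWord : ∀ z → ∃₂ λ c cs → z ≡ replicate c false ++ gapWord cs
falses-then-gapWord []          = 0 , [] , refl
falses-then-gapWord (true ∷ z)  with falses-then-gapWord z
... | c , cs , refl = 0 , c ∷ cs , refl
falses-then-gapWord (false ∷ z) with falses-then-gapWord z
... | c , cs , refl = suc c , cs , refl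

one-then-gapWord : ∀ z → ∃[ cs ] (true ∷ z ≡ gapWord cs)
one-then-gapWord z with falses-then-gapWord z
... | c , cs , refl = c ∷ cs , refl

-- Words that are empty or start with a 1: exactly the gap words.
data Headed : List Bool → Set where
  empty : Headed []
  one∷  : ∀ z → Headed (true ∷ z)

gapWord-headed : ∀ cs → Headed (gapWord cs)
gapWord-headed []      = empty
gapWord-headed (_ ∷ _) = one∷ _

headed-prefix : ∀ u {v} → Headed (u ++ v) → Headed u
headed-prefix []         _ = empty
headed-prefix (true ∷ u) _ = one∷ u
headed-prefix (false ∷ u) ()

headed⇒gapWord : ∀ {w} → Headed w → ∃[ cs ] (w ≡ gapWord cs)
headed⇒gapWord empty    = [] , refl
headed⇒gapWord (one∷ z) = one-then-gapWord z

falses-cancel : ∀ c d {w w′} → Headed w → Headed w′ →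
                replicate c false ++ w ≡ replicate d false ++ w′ → c ≡ d × w ≡ w′
falses-cancel zero    zero    _        _        eq = refl , eq
falses-cancel (suc c) (suc d) h        h′       eq with falses-cancel c d h h′ (∷-injectiveʳ eq)
... | refl , w≡w′ = refl , w≡w′
falses-cancel zero    (suc d) empty    _        ()
falses-cancel zero    (suc d) (one∷ _) _        ()
falses-cancel (suc c) zero    _        empty    ()
falses-cancel (suc c) zero    _        (one∷ _) ()

gapWord-injective : ∀ cs ds → gapWord cs ≡ gapWord ds → cs ≡ ds
gapWord-injective []       []       _  = refl
gapWord-injective []       (_ ∷ _)  ()
gapWord-injective (_ ∷ _)  []       ()
gapWord-injective (c ∷ cs) (d ∷ ds) eq
  with refl , eq′ ← falses-cancel c d (gapWord-headed cs) (gapWord-headed ds) (∷-injectiveʳ eq)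
  = cong (c ∷_) (gapWord-injective cs ds eq′)

gapWord-↻ : ∀ {cs ds} → cs ↻ ds → gapWord cs ↻ gapWord ds
gapWord-↻ (u , v , refl , refl) = gapWord u , gapWord v , gapWord-++ u v , gapWord-++ v u

-- … and conversely: a rotation between gap words cuts both just before a 1,
-- so both pieces are gap words themselves.
↻-gapWord : ∀ {cs ds} → gapWord cs ↻ gapWord ds → cs ↻ ds
↻-gapWord {cs} {ds} (u , v , cs≡ , ds≡)
  with headed⇒gapWord (headed-prefix u (subst Headed cs≡ (gapWord-headed cs)))
     | headed⇒gapWord (headed-prefix v (subst Headed ds≡ (gapWord-headed ds)))
... | cs₁ , refl | cs₂ , refl =
  cs₁ , cs₂ , gapWord-injective cs (cs₁ ++ cs₂) (trans cs≡ (sym (gapWord-++ cs₁ cs₂)))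
            , gapWord-injective ds (cs₂ ++ cs₁) (trans ds≡ (sym (gapWord-++ cs₂ cs₁)))

cut-before-one : ∀ {w} → true ∈ w → ∃[ cs ] (w ↻ gapWord cs)
cut-before-one t with ∈-∃++ t
... | u , v , refl with one-then-gapWord (v ++ u)
... | cs , e = cs , u , true ∷ v , refl , sym e

infix 4 _≤ʷ_

_≤ʷ_ : List Bool → List Bool → Set
_≤ʷ_ = Pointwise B._≤_

-- Raising 0's of  gapWord cs  to 1's only splits its blocks: the result is a
-- gap word whose block lengths refine those of cs.
gapWord-≤⇒Refines : ∀ cs {ys} → gapWord cs ≤ʷ ys →
                    ∃[ ds ] (ys ≡ gapWord ds × Refines (map suc cs) (map suc ds))
gapWord-≤⇒Refines []       []            = [] , refl , ref-[]
gapWord-≤⇒Refines (c ∷ cs) (B.b≤b ∷ p) with Pointwise-split (replicate c false) p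
... | zs₁ , zs₂ , refl , p₁ , p₂ with gapWord-≤⇒Refines cs p₂ | one-then-gapWord zs₁
... | _ | [] , ()
... | ds₂ , refl , refines | d ∷ ds₁ , e₁ =
  d ∷ ds₁ ++ ds₂ , trans (cong (_++ gapWord ds₂) e₁) (sym (gapWord-++ (d ∷ ds₁) ds₂))
  , subst (Refines _) (sym (map-++ suc (d ∷ ds₁) ds₂)) (ref-∷ _ (λ ()) block-sum refines)
  where
    open ≡-Reasoning
    block-sum : sum (map suc (d ∷ ds₁)) ≡ suc c
    block-sum = begin
      sum (map suc (d ∷ ds₁))        ≡⟨ length-gapWord (d ∷ ds₁) ⟨
      length (gapWord (d ∷ ds₁))     ≡⟨ cong length e₁ ⟨
      suc (length zs₁)               ≡⟨ cong suc (Pointwise-length p₁) ⟨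
      suc (length (replicate c false)) ≡⟨ cong suc (length-replicate c) ⟩
      suc c                          ∎

falses-≤ʷ : ∀ z → replicate (length z) false ≤ʷ z
falses-≤ʷ []          = []
falses-≤ʷ (true ∷ z)  = B.f≤t ∷ falses-≤ʷ z
falses-≤ʷ (false ∷ z) = B.b≤b ∷ falses-≤ʷ z

suc-pred-positive : ∀ a → All (0 <_) a → map suc (map pred a) ≡ a
suc-pred-positive []          []      = refl
suc-pred-positive (suc c ∷ a) (_ ∷ p) = cong (suc c ∷_) (suc-pred-positive a p)

block-≤ʷ : ∀ {a} bs → bs ≢ [] → sum bs ≡ a → All (0 <_) bs →
           true ∷ replicate (pred a) false ≤ʷ gapWord (map pred bs)
block-≤ʷ []       ne _ _   = ⊥-elim (ne refl)
block-≤ʷ {a} (b ∷ bs) _ sum≡ pos =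
  B.b≤b ∷ subst (λ k → replicate k false ≤ʷ zeros-then-rest) (cong pred length≡)
                 (falses-≤ʷ zeros-then-rest)
  where
    open ≡-Reasoning
    zeros-then-rest : List Bool
    zeros-then-rest = replicate (pred b) false ++ gapWord (map pred bs)

    length≡ : length (gapWord (map pred (b ∷ bs))) ≡ a
    length≡ = begin
      length (gapWord (map pred (b ∷ bs))) ≡⟨ length-gapWord (map pred (b ∷ bs)) ⟩
      sum (map suc (map pred (b ∷ bs)))    ≡⟨ cong sum (suc-pred-positive (b ∷ bs) pos) ⟩
      sum (b ∷ bs)                         ≡⟨ sum≡ ⟩
      a                                    ∎

Refines⇒gapWord-≤ : ∀ {a b} → Refines a b → All (0 <_) b →
                    gapWord (map pred a) ≤ʷ gapWord (map pred b)
Refines⇒gapWord-≤ ref-[] _ = []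
Refines⇒gapWord-≤ (ref-∷ {rest = rest} bs ne sum≡ refines) pos with All.++⁻ bs pos
... | pos-bs , pos-rest =
  subst (_ ≤ʷ_) (sym split)
        (++⁺ (block-≤ʷ bs ne sum≡ pos-bs) (Refines⇒gapWord-≤ refines pos-rest))
  where
    split : gapWord (map pred (bs ++ rest)) ≡ gapWord (map pred bs) ++ gapWord (map pred rest)
    split = trans (cong gapWord (map-++ pred bs rest)) (gapWord-++ (map pred bs) (map pred rest))

<⇒≤∸1 : ∀ {m k} → m < k → m ≤ k ∸ 1
<⇒≤∸1 (s≤s m≤k) = m≤k

≤∸1⇒< : ∀ {m k} → 1 ≤ m → m ≤ k ∸ 1 → m < k
≤∸1⇒< {suc m} {zero}  _ ()
≤∸1⇒< {k = suc k}     _ m≤k = s≤s m≤k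

positive-suc : ∀ cs → All (0 <_) (map suc cs)
positive-suc cs = All.map⁺ (universal (λ _ → 0<1+n) cs)

module _ {n : ℕ} where

  gaps : NWord n → List ℕ
  gaps (_ , _ , t , _) = proj₁ (cut-before-one t)

  gaps-↻ : (x : NWord n) → proj₁ x ↻ gapWord (gaps x)
  gaps-↻ (_ , _ , t , _) = proj₂ (cut-before-one t)

  length-gaps : (x : NWord n) → length (gaps x) ≡ rankN x
  length-gaps x = sym (trans (↻-countTrue (gaps-↻ x)) (countTrue-gapWord (gaps x)))

  ψ : NWord n → Part n
  ψ x@(w , length≡n , t , f) =
    map suc (gaps x) , positive-suc (gaps x) , sum≡n , nonempty , proper
    where
      parts≡ones : length (map suc (gaps x)) ≡ countTrue w
      parts≡ones = trans (length-map suc (gaps x)) (length-gaps x)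
      sum≡n : sum (map suc (gaps x)) ≡ n
      sum≡n = trans (sym (length-gapWord (gaps x))) (trans (sym (↻-length (gaps-↻ x))) length≡n)
      nonempty : 1 ≤ length (map suc (gaps x))
      nonempty = subst (1 ≤_) (sym parts≡ones) (true∈⇒countTrue t)
      proper : length (map suc (gaps x)) ≤ n ∸ 1
      proper = <⇒≤∸1 (subst₂ _<_ (sym parts≡ones) length≡n (false∈⇒countTrue f))

  ψ-gapWord : ∀ x {cs} → proj₁ x ↻ gapWord cs → proj₁ (ψ x) ↻ map suc cs
  ψ-gapWord x r = ↻-map suc (↻-gapWord (↻-trans (↻-sym (gaps-↻ x)) r))

  ψ-gapWord⁻ : ∀ x {a} → proj₁ (ψ x) ↻ a → proj₁ x ↻ gapWord (map pred a)
  ψ-gapWord⁻ x r = ↻-trans (gaps-↻ x) (gapWord-↻ (↻-unsuc r))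

  ψ-respects : ∀ x y → x ~N y → ψ x ~Q ψ y
  ψ-respects x y x~y = ↻⇒Rot (ψ-gapWord x (↻-trans (Rot⇒↻ x~y) (gaps-↻ y)))

  ψ-reflects : ∀ x y → ψ x ~Q ψ y → x ~N y
  ψ-reflects x y ψx~ψy = ↻⇒Rot (↻-trans x↻gaps-y (↻-sym (gaps-↻ y)))
    where
      x↻gaps-y : proj₁ x ↻ gapWord (gaps y)
      x↻gaps-y = subst (λ cs → proj₁ x ↻ gapWord cs) (map-pred-suc (gaps y))
                       (ψ-gapWord⁻ x (Rot⇒↻ ψx~ψy))

  -- The partition necklace [a] is the image of the gap word of a - 1.
  ψ-surjective : ∀ q → ∃[ x ] (ψ x ~Q q)
  ψ-surjective (a , pos , sum≡n , nonempty , proper) =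
    x , ↻⇒Rot (subst (proj₁ (ψ x) ↻_) (suc-pred-positive a pos) (ψ-gapWord x ↻-refl))
    where
      w : List Bool
      w = gapWord (map pred a)
      ones : countTrue w ≡ length a
      ones = trans (countTrue-gapWord (map pred a)) (length-map pred a)
      length≡n : length w ≡ n
      length≡n = trans (length-gapWord (map pred a))
                       (trans (cong sum (suc-pred-positive a pos)) sum≡n)
      x : NWord n
      x = w , length≡n
            , countTrue⇒true∈ w (subst (1 ≤_) (sym ones) nonempty)
            , countTrue⇒false∈ w (subst₂ _<_ (sym ones) (sym length≡n) (≤∸1⇒< nonempty proper))

  -- Rotate x′ to a gap word; rotating y′ along keeps it above, so it is the
  -- gap word of a refinement.
  ψ-monotone : ∀ x y → x ≤N y → ψ x ≤Q ψ y
  ψ-monotone x@(_ , _ , t , _) y (x′ , y′ , x~x′ , y~y′ , x′≤y′)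
    with cut-before-one (↻-∈ t (Rot⇒↻ x~x′))
  ... | cs , x′↻ with ↻-Pointwise x′≤y′ x′↻
  ... | y″ , y′↻y″ , cs≤y″ with gapWord-≤⇒Refines cs cs≤y″
  ... | ds , refl , refines =
    map suc cs , map suc ds
    , ↻⇒Rot (ψ-gapWord x (↻-trans (Rot⇒↻ x~x′) x′↻))
    , ↻⇒Rot (ψ-gapWord y (↻-trans (Rot⇒↻ y~y′) y′↻y″))
    , refines

  ψ-reflects-≤ : ∀ x y → ψ x ≤Q ψ y → x ≤N y
  ψ-reflects-≤ x y (a′ , b′ , ψx~a′ , ψy~b′ , refines) =
    gapWord (map pred a′) , gapWord (map pred b′)
    , ↻⇒Rot (ψ-gapWord⁻ x (Rot⇒↻ ψx~a′))
    , ↻⇒Rot (ψ-gapWord⁻ y (Rot⇒↻ ψy~b′))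
    , Refines⇒gapWord-≤ refines (↻-All (positive-suc (gaps y)) (Rot⇒↻ ψy~b′))

  ψ-rank : ∀ x → rankQ (ψ x) ≡ rankN x
  ψ-rank x = trans (length-map suc (gaps x)) (length-gaps x)

  ψ-formula : ∀ cs (x : NWord n) → proj₁ x ≡ gapWord cs → Rot (proj₁ (ψ x)) (map suc cs)
  ψ-formula cs x x≡ = ↻⇒Rot (ψ-gapWord x (subst (proj₁ x ↻_) x≡ ↻-refl))

proposition3p1 : (n : ℕ) → 1 ≤ n → Σ (NWord n → Part n) IsRankedIso
proposition3p1 n _ =
  ψ , ψ-respects , ψ-reflects , ψ-surjective
  , (λ x y → mk⇔ (ψ-monotone x y) (ψ-reflects-≤ x y))
  , ψ-rank , ψ-formula
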